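{- Let $D$ be a tournament, $C$ a directed cycle of $D$ and $v\in V(C)$. Then there is a sequence $\mathcal C_v\in\mathrm{rs}(D)$ consisting of directed 3-cycles such that $D^{C}=D^{\mathcal C_v}$ and every edge of every cycle in $\mathcal C_v$ either contains $v$ or is an edge of $C$.
   Context: A tournament is a digraph (no loops) in which for all distinct $u,v$ exactly one of $uv$, $vu$ is an arc. For a directed cycle $C$, $D^{C}$ is the digraph on $V(D)$ with arc set $(A(D)\setminus A(C))\cup\{vu: uv\in A(C)\}$. $\mathrm{rs}(D)$ contains the finite sequences $\langle C_0,\dots,C_{k-1}\rangle$ in which each $C_i$ is a directed cycle of $D^{\langle C_0,\dots,C_{i-1}\rangle}$, where $D^\emptyset=D$ and $D^{\mathcal C^\frown\langle C\rangle}=(D^{\mathcal C})^C$. Edges are unordered pairs underlying arcs. -}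

module Defs where

open import Data.Nat using (ℕ; _≤_)
open import Data.Fin using (Fin)
open import Data.Fin.Properties using (_≟_)
open import Data.Bool using (Bool; true; false; _∧_; _∨_; not)
open import Data.Product using (_×_; _,_)
open import Data.Sum using (_⊎_)
open import Data.Unit using (⊤)
open import Data.Empty using (⊥)
open import Data.List using (List; []; _∷_; _++_; [_]; zip; length; foldl)
open import Data.Bool.ListAction using (any)
open import Data.List.Relation.Unary.All using (All)
open import Data.List.Relation.Unary.Unique.Propositional using (Unique)
open import Relation.Nullary using (¬_)
open import Relation.Nullary.Decidable using (⌊_⌋)
open import Relation.Binary.PropositionalEquality using (_≡_)

Digraph : ℕ → Set
Digraph n = Fin n → Fin n → Bool

Arc : ∀ {n} → Digraph n → Fin n → Fin n → Set
Arc D u v = D u v ≡ true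

IsTournament : ∀ {n} → Digraph n → Set
IsTournament {n} D =
  ((u : Fin n) → D u u ≡ false) ×
  ((u v : Fin n) → ¬ (u ≡ v) → (Arc D u v ⊎ Arc D v u) × ¬ (Arc D u v × Arc D v u))

-- A directed cycle is given by its cyclic vertex sequence [c₀, …, c_{k-1}];
-- its arcs are c₀c₁, c₁c₂, …, c_{k-2}c_{k-1}, c_{k-1}c₀.
cycArcs : ∀ {n} → List (Fin n) → List (Fin n × Fin n)
cycArcs []       = []
cycArcs (x ∷ xs) = zip (x ∷ xs) (xs ++ [ x ])

IsCycle : ∀ {n} → Digraph n → List (Fin n) → Set
IsCycle D cs = (2 ≤ length cs) × Unique cs × All (λ { (u , v) → Arc D u v }) (cycArcs cs)

memArc : ∀ {n} → List (Fin n × Fin n) → Fin n → Fin n → Bool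
memArc as u v = any (λ { (x , y) → ⌊ x ≟ u ⌋ ∧ ⌊ y ≟ v ⌋ }) as

rev : ∀ {n} → Digraph n → List (Fin n) → Digraph n
rev D C u v = (D u v ∧ not (memArc (cycArcs C) u v)) ∨ memArc (cycArcs C) v u

-- D^⟨C₀,…,C_{k-1}⟩, applying C₀ first.
revSeq : ∀ {n} → Digraph n → List (List (Fin n)) → Digraph n
revSeq D Cs = foldl rev D Cs

IsRS : ∀ {n} → Digraph n → List (List (Fin n)) → Set
IsRS D []       = ⊤
IsRS D (C ∷ Cs) = IsCycle D C × IsRS (rev D C) Cs

EdgeOf : ∀ {n} → List (Fin n) → Fin n → Fin n → Set
EdgeOf C x y = memArc (cycArcs C) x y ≡ true ⊎ memArc (cycArcs C) y x ≡ true

-- For a tournament D and a set K of arcs of D, reversing K changes exactly the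
-- edges underlying K: D^K = D xor E(K), where E(K) is the symmetric edge set of K.
-- A cycle v c₁ c₂ … of length at least 4 has the chord {v, c₂}, which splits it
-- into the triangle T = v c₁ c₂ and the shorter cycle C′ = v c₂ …; as edge sets,
-- E(C) = E(C′) xor E(T).  Whichever way the chord is oriented in D, one of C′, T
-- is a cycle of D and the other becomes a cycle after reversing the first, so
-- D^C = (D^C′)^T or D^C = (D^T)^C′, and induction on the length of C handles C′.
-- Every edge created along the way is an edge of C or contains v.
module Submission where

open import Defs
open import Data.Nat using (ℕ; _≤_; s≤s; z≤n)
open import Data.Fin using (Fin)
open import Data.Fin.Properties using (_≟_)
open import Data.Bool using (Bool; true; false; _∧_; _∨_; not; _xor_)
open import Data.Bool.Properties
  using (∨-comm; ∨-assoc; ∨-zeroʳ; ∧-comm; ¬-not; not-distribˡ-xor; xor-assoc; xor-comm; ∨-commutativeMonoid)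
open import Data.Product using (Σ; _×_; _,_; proj₁; proj₂) renaming (map to map×)
open import Data.Sum using (_⊎_; inj₁; inj₂; [_,_]′; swap) renaming (map to map⊎)
open import Data.Unit using (tt)
open import Function using (_∘_)
open import Data.Empty using (⊥; ⊥-elim)
open import Data.List using (List; []; _∷_; _++_; [_]; zip; length)
open import Data.List.Properties using (length-++-comm; ++-identityʳ; foldl-++)
open import Data.List.Relation.Unary.All as All using (All; []; _∷_)
open import Data.List.Relation.Unary.All.Properties using (All¬⇒¬Any; ++⁺)
open import Data.List.Relation.Unary.Any using (here; there)
import Data.List.Relation.Unary.AllPairs as AllPairs
open import Data.List.Relation.Unary.Unique.Propositional using (Unique)
open import Data.List.Membership.Propositional using (_∈_; _∉_)
open import Data.List.Membership.Propositional.Properties using (∈-∃++; ∈-++⁻)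
import Data.List.Relation.Binary.Permutation.Setoid.Properties as Permutation
open import Algebra.Bundles using (CommutativeMonoid)
open import Algebra.Properties.CommutativeSemigroup
  (CommutativeMonoid.commutativeSemigroup ∨-commutativeMonoid) using (interchange)
open import Relation.Nullary using (¬_; yes; no)
open import Relation.Nullary.Decidable using (⌊_⌋)
open import Relation.Binary.PropositionalEquality
  using (_≡_; refl; sym; trans; cong; cong₂; subst; _≢_; setoid; ≡-≟-identity; module ≡-Reasoning)

private
  variable
    n : ℕ
    a b v x y : Fin n
    ps qs : List (Fin n × Fin n)
    K K₁ K₂ : List (Fin n)
    D D′ : Digraph n

reversal-as-xor : ∀ d m m′ → (m ≡ true → d ≡ true) → (m′ ≡ true → d ≡ false) →
  (d ∧ not m) ∨ m′ ≡ d xor (m ∨ m′)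
reversal-as-xor true  _     true  _ absent with absent refl
... | ()
reversal-as-xor false true  true  _ _ = refl
reversal-as-xor false false true  _ _ = refl
reversal-as-xor true  true  false _ _ = refl
reversal-as-xor false true  false present _ with present refl
... | ()
reversal-as-xor true  false false _ _ = refl
reversal-as-xor false false false _ _ = refl

∨≡xor-of-disjoint : ∀ p q r → (p ≡ true → q ∨ r ≡ true → ⊥) → (q ≡ true → r ≡ true → ⊥) →
  p ∨ r ≡ (q ∨ r) xor (p ∨ q)
∨≡xor-of-disjoint true  false false _ _ = refl
∨≡xor-of-disjoint true  true  _     disj _ = ⊥-elim (disj refl refl)
∨≡xor-of-disjoint true  false true  disj _ = ⊥-elim (disj refl refl)
∨≡xor-of-disjoint false true  true  _ disj = ⊥-elim (disj refl refl)
∨≡xor-of-disjoint false true  false _ _ = refl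
∨≡xor-of-disjoint false false true  _ _ = refl
∨≡xor-of-disjoint false false false _ _ = refl

false≢true : false ≢ true
false≢true ()

exactly-one : ∀ p q → q ≡ not p → (p ≡ true ⊎ q ≡ true) × ¬ (p ≡ true × q ≡ true)
exactly-one true  .false refl = inj₁ refl , λ ()
exactly-one false .true  refl = inj₂ refl , λ ()

∈-zip⁻ : ∀ {A B : Set} {xs : List A} {ys : List B} {a b} → (a , b) ∈ zip xs ys → a ∈ xs × b ∈ ys
∈-zip⁻ {xs = _ ∷ _} {_ ∷ _} (here refl) = here refl , here refl
∈-zip⁻ {xs = _ ∷ _} {_ ∷ _} (there p)   = map× there there (∈-zip⁻ p)

∈-cycArcs⁻ : (x , y) ∈ cycArcs K → x ∈ K × y ∈ K
∈-cycArcs⁻ {K = c ∷ cs} p with ∈-zip⁻ p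
... | x∈ , y∈ = x∈ , [ there , (λ { (here refl) → here refl }) ]′ (∈-++⁻ cs y∈)

memArc⇒∈ : ∀ ps → memArc ps x y ≡ true → (x , y) ∈ ps
memArc⇒∈ {x = x} {y} ((a , b) ∷ ps) m with a ≟ x | b ≟ y
... | yes refl | yes refl = here refl
... | yes _    | no _     = there (memArc⇒∈ ps m)
... | no _     | _        = there (memArc⇒∈ ps m)

∈⇒memArc : (x , y) ∈ ps → memArc ps x y ≡ true
∈⇒memArc {x = x} {y = y} (here refl)
  rewrite ≡-≟-identity _≟_ (refl {x = x}) | ≡-≟-identity _≟_ (refl {x = y}) = refl
∈⇒memArc {x = x} {y = y} {ps = (a , b) ∷ _} (there p) =
  trans (cong ((⌊ a ≟ x ⌋ ∧ ⌊ b ≟ y ⌋) ∨_) (∈⇒memArc p)) (∨-zeroʳ _)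

memArc-++ : ∀ ps qs → memArc (ps ++ qs) x y ≡ memArc ps x y ∨ memArc qs x y
memArc-++ []              qs = refl
memArc-++ {x = x} {y} ((a , b) ∷ ps) qs =
  trans (cong ((⌊ a ≟ x ⌋ ∧ ⌊ b ≟ y ⌋) ∨_) (memArc-++ ps qs))
        (sym (∨-assoc (⌊ a ≟ x ⌋ ∧ ⌊ b ≟ y ⌋) (memArc ps x y) (memArc qs x y)))

Edge : List (Fin n × Fin n) → Fin n → Fin n → Set
Edge ps x y = (x , y) ∈ ps ⊎ (y , x) ∈ ps

Edge-++⁻ : ∀ ps → Edge (ps ++ qs) x y → Edge ps x y ⊎ Edge qs x y
Edge-++⁻ ps (inj₁ p) = map⊎ inj₁ inj₁ (∈-++⁻ ps p)
Edge-++⁻ ps (inj₂ p) = map⊎ inj₂ inj₂ (∈-++⁻ ps p)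

Edge-single⁻ : Edge [ (a , b) ] x y → (x ≡ a × y ≡ b) ⊎ (x ≡ b × y ≡ a)
Edge-single⁻ (inj₁ (here refl)) = inj₁ (refl , refl)
Edge-single⁻ (inj₂ (here refl)) = inj₂ (refl , refl)

Edge-cycArcs⁻ : Edge (cycArcs K) x y → x ∈ K × y ∈ K
Edge-cycArcs⁻ (inj₁ p) = ∈-cycArcs⁻ p
Edge-cycArcs⁻ (inj₂ p) with ∈-cycArcs⁻ p
... | y∈ , x∈ = x∈ , y∈

EdgeDisjoint : List (Fin n × Fin n) → List (Fin n × Fin n) → Set
EdgeDisjoint ps qs = ∀ {x y} → Edge ps x y → Edge qs x y → ⊥

single-disjoint : (Edge qs a b → ⊥) → EdgeDisjoint [ (a , b) ] qs
single-disjoint ¬ab e e′ with Edge-single⁻ e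
... | inj₁ (refl , refl) = ¬ab e′
... | inj₂ (refl , refl) = ¬ab (swap e′)

hasEdge : List (Fin n × Fin n) → Fin n → Fin n → Bool
hasEdge ps x y = memArc ps x y ∨ memArc ps y x

hasEdge⇒Edge : ∀ ps → hasEdge ps x y ≡ true → Edge ps x y
hasEdge⇒Edge {x = x} {y} ps e with memArc ps x y in m
... | true  = inj₁ (memArc⇒∈ ps m)
... | false = inj₂ (memArc⇒∈ ps e)

Edge⇒hasEdge : Edge ps x y → hasEdge ps x y ≡ true
Edge⇒hasEdge (inj₁ p) rewrite ∈⇒memArc p = refl
Edge⇒hasEdge {ps = ps} {x = x} (inj₂ p) rewrite ∈⇒memArc p = ∨-zeroʳ (memArc ps x _)

¬Edge⇒¬hasEdge : ∀ ps → ¬ Edge ps x y → hasEdge ps x y ≡ false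
¬Edge⇒¬hasEdge ps ¬e = ¬-not (λ e → ¬e (hasEdge⇒Edge ps e))

hasEdge-sym : ∀ ps (x y : Fin n) → hasEdge ps x y ≡ hasEdge ps y x
hasEdge-sym ps x y = ∨-comm (memArc ps x y) (memArc ps y x)

hasEdge-++ : ∀ ps qs (x y : Fin n) → hasEdge (ps ++ qs) x y ≡ hasEdge ps x y ∨ hasEdge qs x y
hasEdge-++ ps qs x y =
  trans (cong₂ _∨_ (memArc-++ ps qs) (memArc-++ ps qs))
        (interchange (memArc ps x y) (memArc qs x y) (memArc ps y x) (memArc qs y x))

hasEdge-flip : ∀ (a b x y : Fin n) → hasEdge [ (a , b) ] x y ≡ hasEdge [ (b , a) ] x y
hasEdge-flip a b x y = trans (∨-comm (memArc [ (a , b) ] x y) (memArc [ (a , b) ] y x))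
  (cong₂ (λ p q → (p ∨ false) ∨ (q ∨ false))
         (∧-comm ⌊ a ≟ y ⌋ ⌊ b ≟ x ⌋) (∧-comm ⌊ a ≟ x ⌋ ⌊ b ≟ y ⌋))

ArcsOf : Digraph n → List (Fin n × Fin n) → Set
ArcsOf D ps = All (λ { (u , w) → Arc D u w }) ps

reverse-arc-absent : IsTournament D → Arc D y x → D x y ≡ false
reverse-arc-absent {y = y} {x = x} (loopless , oriented) yx with x ≟ y
... | yes refl = loopless x
... | no x≢y   = ¬-not (λ xy → proj₂ (oriented x y x≢y) (xy , yx))

tournament-converse : IsTournament D → x ≢ y → D y x ≡ not (D x y)
tournament-converse {D = D} {x = x} {y = y} t@(_ , oriented) x≢y with D x y in xy
... | true  = reverse-arc-absent t xy
... | false with proj₁ (oriented x y x≢y)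
...   | inj₁ xy′ = ⊥-elim (false≢true (trans (sym xy) xy′))
...   | inj₂ yx  = yx

rev-as-xor : ∀ K → IsTournament D → ArcsOf D (cycArcs K) →
  ∀ x y → rev D K x y ≡ D x y xor hasEdge (cycArcs K) x y
rev-as-xor {D = D} K t arcs x y =
  reversal-as-xor (D x y) (memArc L x y) (memArc L y x)
    (λ m → All.lookup arcs (memArc⇒∈ L m))
    (λ m → reverse-arc-absent t (All.lookup arcs (memArc⇒∈ L m)))
  where L = cycArcs K

rev-keeps-arc : ∀ K → IsTournament D → ArcsOf D (cycArcs K) →
  hasEdge (cycArcs K) x y ≡ false → Arc D x y → Arc (rev D K) x y
rev-keeps-arc K t arcs no-edge xy =
  trans (rev-as-xor K t arcs _ _) (cong₂ _xor_ xy no-edge)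

rev-reverses-arc : ∀ K → IsTournament D → ArcsOf D (cycArcs K) →
  hasEdge (cycArcs K) x y ≡ true → Arc D y x → Arc (rev D K) x y
rev-reverses-arc K t arcs edge yx =
  trans (rev-as-xor K t arcs _ _) (cong₂ _xor_ (reverse-arc-absent t yx) edge)

rev-isTournament : ∀ K → IsTournament D → ArcsOf D (cycArcs K) → IsTournament (rev D K)
rev-isTournament {D = D} K t@(loopless , _) arcs = rev-loopless , rev-oriented
  where
  open ≡-Reasoning
  L = cycArcs K
  rev-loopless : ∀ u → rev D K u u ≡ false
  rev-loopless u = begin
    rev D K u u                 ≡⟨ rev-as-xor K t arcs u u ⟩
    D u u xor hasEdge L u u     ≡⟨ cong₂ _xor_ (loopless u) no-loop ⟩
    false                       ∎
    where
    no-loop : hasEdge L u u ≡ false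
    no-loop = ¬Edge⇒¬hasEdge L λ e →
      false≢true (trans (sym (loopless u)) (All.lookup arcs ([ (λ p → p) , (λ p → p) ]′ e)))
  rev-oriented : ∀ u w → u ≢ w →
    (Arc (rev D K) u w ⊎ Arc (rev D K) w u) × ¬ (Arc (rev D K) u w × Arc (rev D K) w u)
  rev-oriented u w u≢w = exactly-one (rev D K u w) (rev D K w u) (begin
    rev D K w u                          ≡⟨ rev-as-xor K t arcs w u ⟩
    D w u xor hasEdge L w u              ≡⟨ cong₂ _xor_ (tournament-converse t u≢w) (hasEdge-sym L w u) ⟩
    not (D u w) xor hasEdge L u w        ≡⟨ not-distribˡ-xor (D u w) (hasEdge L u w) ⟨
    not (D u w xor hasEdge L u w)        ≡⟨ cong not (rev-as-xor K t arcs u w) ⟨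
    not (rev D K u w)                    ∎)

rev-split : ∀ K K₁ K₂ → IsTournament D →
  ArcsOf D (cycArcs K) → ArcsOf D (cycArcs K₁) → ArcsOf (rev D K₁) (cycArcs K₂) →
  (∀ x y → hasEdge (cycArcs K) x y ≡ hasEdge (cycArcs K₁) x y xor hasEdge (cycArcs K₂) x y) →
  ∀ x y → rev D K x y ≡ rev (rev D K₁) K₂ x y
rev-split {D = D} K K₁ K₂ t arcs arcs₁ arcs₂ split x y = begin
  rev D K x y                                   ≡⟨ rev-as-xor K t arcs x y ⟩
  D x y xor hasEdge (cycArcs K) x y             ≡⟨ cong (D x y xor_) (split x y) ⟩
  D x y xor (E₁ xor E₂)                         ≡⟨ xor-assoc (D x y) E₁ E₂ ⟨
  (D x y xor E₁) xor E₂                         ≡⟨ cong (_xor E₂) (rev-as-xor K₁ t arcs₁ x y) ⟨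
  rev D K₁ x y xor E₂                           ≡⟨ rev-as-xor K₂ (rev-isTournament K₁ t arcs₁) arcs₂ x y ⟨
  rev (rev D K₁) K₂ x y                         ∎
  where
  open ≡-Reasoning
  E₁ = hasEdge (cycArcs K₁) x y
  E₂ = hasEdge (cycArcs K₂) x y

IsCycle-resp : (∀ x y → D x y ≡ D′ x y) → IsCycle D K → IsCycle D′ K
IsCycle-resp same (long , unique , arcs) =
  long , unique , All.map (λ {p} a → trans (sym (same (proj₁ p) (proj₂ p))) a) arcs

rev-cong : (∀ x y → D x y ≡ D′ x y) → ∀ K x y → rev D K x y ≡ rev D′ K x y
rev-cong same K x y =
  cong (λ d → (d ∧ not (memArc (cycArcs K) x y)) ∨ memArc (cycArcs K) y x) (same x y)

IsRS-snoc : ∀ (D : Digraph n) Ks → IsRS D Ks → IsCycle (revSeq D Ks) K → IsRS D (Ks ++ [ K ])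
IsRS-snoc D []       _          cyc = cyc , tt
IsRS-snoc D (C ∷ Ks) (cycC , rs) cyc = cycC , IsRS-snoc (rev D C) Ks rs cyc

Near : Fin n → List (Fin n) → Fin n × Fin n → Set
Near v C (x , y) = x ≡ v ⊎ y ≡ v ⊎ EdgeOf C x y

Near-transfer : (∀ {x y} → (x , y) ∈ cycArcs K₁ → x ≡ v ⊎ (x , y) ∈ cycArcs K₂) →
  ∀ {p} → Near v K₁ p → Near v K₂ p
Near-transfer sub (inj₁ x≡v)               = inj₁ x≡v
Near-transfer sub (inj₂ (inj₁ y≡v))        = inj₂ (inj₁ y≡v)
Near-transfer sub (inj₂ (inj₂ (inj₁ xy))) =
  [ inj₁ , (λ p → inj₂ (inj₂ (inj₁ (∈⇒memArc p)))) ]′ (sub (memArc⇒∈ _ xy))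
Near-transfer sub (inj₂ (inj₂ (inj₂ yx))) =
  [ (λ y≡v → inj₂ (inj₁ y≡v)) , (λ p → inj₂ (inj₂ (inj₂ (∈⇒memArc p)))) ]′ (sub (memArc⇒∈ _ yx))

record Decomposition (D : Digraph n) (v : Fin n) (C : List (Fin n)) : Set where
  field
    triangles     : List (List (Fin n))
    isRS          : IsRS D triangles
    all-length-3  : All (λ T → length T ≡ 3) triangles
    same-reversal : ∀ x y → rev D C x y ≡ revSeq D triangles x y
    all-near      : All (λ T → All (Near v C) (cycArcs T)) triangles

Decomposable : Fin n → List (Fin n) → Set
Decomposable {n} v C = ∀ {D : Digraph n} → IsTournament D → IsCycle D C → Decomposition D v C

module Chord {n} {v c₁ c₂ c₃ : Fin n} {r : List (Fin n)} (uniq : Unique (v ∷ c₁ ∷ c₂ ∷ c₃ ∷ r)) where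

  C C′ T : List (Fin n)
  C  = v ∷ c₁ ∷ c₂ ∷ c₃ ∷ r
  C′ = v ∷ c₂ ∷ c₃ ∷ r
  T  = v ∷ c₁ ∷ c₂ ∷ []

  -- cycArcs C = A ++ path, cycArcs C′ = (v , c₂) ∷ path and cycArcs T = A ++ [ (c₂ , v) ].
  A path : List (Fin n × Fin n)
  A    = (v , c₁) ∷ (c₁ , c₂) ∷ []
  path = zip (c₂ ∷ c₃ ∷ r) (c₃ ∷ r ++ [ v ])

  v≢c₁ : v ≢ c₁
  v≢c₁ = All.head (AllPairs.head uniq)

  v≢c₂ : v ≢ c₂
  v≢c₂ = All.head (All.tail (AllPairs.head uniq))

  c₁≢c₂ : c₁ ≢ c₂
  c₁≢c₂ = All.head (AllPairs.head (AllPairs.tail uniq))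

  unique-C′ : Unique C′
  unique-C′ = All.tail (AllPairs.head uniq) AllPairs.∷ AllPairs.tail (AllPairs.tail uniq)

  unique-T : Unique T
  unique-T = (v≢c₁ ∷ v≢c₂ ∷ []) AllPairs.∷ (c₁≢c₂ ∷ []) AllPairs.∷ [] AllPairs.∷ AllPairs.[]

  c₁∉C′ : c₁ ∉ C′
  c₁∉C′ (here c₁≡v) = v≢c₁ (sym c₁≡v)
  c₁∉C′ (there p)   = All¬⇒¬Any (AllPairs.head (AllPairs.tail uniq)) p

  v∉c₂∷c₃∷r : v ∉ c₂ ∷ c₃ ∷ r
  v∉c₂∷c₃∷r = All¬⇒¬Any (All.tail (AllPairs.head uniq))

  c₂∉c₃∷r : c₂ ∉ c₃ ∷ r
  c₂∉c₃∷r = All¬⇒¬Any (AllPairs.head (AllPairs.tail (AllPairs.tail uniq)))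

  C′-misses-c₁ : ∀ {x y} → x ≡ c₁ ⊎ y ≡ c₁ → hasEdge (cycArcs C′) x y ≡ false
  C′-misses-c₁ touch = ¬Edge⇒¬hasEdge (cycArcs C′) λ e →
    c₁∉C′ ([ (λ { refl → proj₁ (Edge-cycArcs⁻ e) }) , (λ { refl → proj₂ (Edge-cycArcs⁻ e) }) ]′ touch)

  A-touches-c₁ : ∀ {x y} → Edge A x y → x ≡ c₁ ⊎ y ≡ c₁
  A-touches-c₁ (inj₁ (here refl))         = inj₂ refl
  A-touches-c₁ (inj₁ (there (here refl))) = inj₁ refl
  A-touches-c₁ (inj₂ (here refl))         = inj₁ refl
  A-touches-c₁ (inj₂ (there (here refl))) = inj₂ refl

  A-disjoint-C′ : EdgeDisjoint A (cycArcs C′)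
  A-disjoint-C′ eA eC′ = false≢true (trans (sym (C′-misses-c₁ (A-touches-c₁ eA))) (Edge⇒hasEdge eC′))

  chord∉path : ¬ Edge path v c₂
  chord∉path (inj₁ p)          = v∉c₂∷c₃∷r (proj₁ (∈-zip⁻ p))
  chord∉path (inj₂ (here e))   = v∉c₂∷c₃∷r (there (here (cong proj₂ e)))
  chord∉path (inj₂ (there p))  = c₂∉c₃∷r (proj₁ (∈-zip⁻ p))

  T-disjoint-path : EdgeDisjoint (cycArcs T) path
  T-disjoint-path eT eP with Edge-++⁻ A eT
  ... | inj₁ eA  = A-disjoint-C′ eA (map⊎ there there eP)
  ... | inj₂ eB  = single-disjoint (λ e → chord∉path (swap e)) eB eP

  hasEdge-split : ∀ x y → hasEdge (cycArcs C) x y ≡ hasEdge (cycArcs C′) x y xor hasEdge (cycArcs T) x y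
  hasEdge-split x y = begin
    hasEdge (A ++ path) x y
      ≡⟨ hasEdge-++ A path x y ⟩
    eA ∨ eP
      ≡⟨ ∨≡xor-of-disjoint eA eB eP disjoint-A disjoint-chord ⟩
    (eB ∨ eP) xor (eA ∨ eB)
      ≡⟨ cong₂ _xor_ (hasEdge-++ B path x y) (cong (eA ∨_) (hasEdge-flip c₂ v x y)) ⟨
    hasEdge (B ++ path) x y xor (eA ∨ eB′)
      ≡⟨ cong (hasEdge (B ++ path) x y xor_) (hasEdge-++ A [ (c₂ , v) ] x y) ⟨
    hasEdge (B ++ path) x y xor hasEdge (A ++ [ (c₂ , v) ]) x y
      ∎
    where
    open ≡-Reasoning
    B = [ (v , c₂) ]
    eA = hasEdge A x y
    eB = hasEdge B x y
    eB′ = hasEdge [ (c₂ , v) ] x y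
    eP = hasEdge path x y
    disjoint-A : eA ≡ true → eB ∨ eP ≡ true → ⊥
    disjoint-A ea ebp = A-disjoint-C′ (hasEdge⇒Edge A ea)
      (hasEdge⇒Edge (B ++ path) (trans (hasEdge-++ B path x y) ebp))
    disjoint-chord : eB ≡ true → eP ≡ true → ⊥
    disjoint-chord eb ep = single-disjoint chord∉path (hasEdge⇒Edge B eb) (hasEdge⇒Edge path ep)

  C′-arc⇒C-arc : ∀ {x y} → (x , y) ∈ cycArcs C′ → x ≡ v ⊎ (x , y) ∈ cycArcs C
  C′-arc⇒C-arc (here e)  = inj₁ (cong proj₁ e)
  C′-arc⇒C-arc (there p) = inj₂ (there (there p))

  T-near : All (Near v C) (cycArcs T)
  T-near = inj₁ refl
         ∷ inj₂ (inj₂ (inj₁ (∈⇒memArc {ps = cycArcs C} (there (here refl)))))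
         ∷ inj₂ (inj₁ refl)
         ∷ []

  C′-near⇒C-near : ∀ {ps} → All (Near v C′) ps → All (Near v C) ps
  C′-near⇒C-near = All.map (Near-transfer {K₁ = C′} {K₂ = C} C′-arc⇒C-arc)

module _ {v c₁ c₂ c₃ : Fin n} {r : List (Fin n)} where

  triangle-last : IsTournament D → IsCycle D (v ∷ c₁ ∷ c₂ ∷ c₃ ∷ r) → Arc D v c₂ →
    Decomposable v (v ∷ c₂ ∷ c₃ ∷ r) → Decomposition D v (v ∷ c₁ ∷ c₂ ∷ c₃ ∷ r)
  triangle-last {D = D} t (_ , uniq , arcs-C@(vc₁ ∷ c₁c₂ ∷ arcs-path)) vc₂ decomposable = record
    { triangles     = triangles ++ [ T ]
    ; isRS          = IsRS-snoc D triangles isRS (IsCycle-resp same-reversal cycle-T)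
    ; all-length-3  = ++⁺ all-length-3 (refl ∷ [])
    ; same-reversal = λ x y → begin
        rev D C x y                       ≡⟨ rev-split C C′ T t arcs-C arcs-C′ arcs-T hasEdge-split x y ⟩
        rev (rev D C′) T x y              ≡⟨ rev-cong same-reversal T x y ⟩
        rev (revSeq D triangles) T x y    ≡⟨ cong (λ E → E x y) (foldl-++ rev D triangles [ T ]) ⟨
        revSeq D (triangles ++ [ T ]) x y ∎
    ; all-near      = ++⁺ (All.map C′-near⇒C-near all-near) (T-near ∷ [])
    }
    where
    open ≡-Reasoning
    open Chord uniq
    arcs-C′ : ArcsOf D (cycArcs C′)
    arcs-C′ = vc₂ ∷ arcs-path
    open Decomposition (decomposable t (s≤s (s≤s z≤n) , unique-C′ , arcs-C′))
    arcs-T : ArcsOf (rev D C′) (cycArcs T)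
    arcs-T = rev-keeps-arc C′ t arcs-C′ (C′-misses-c₁ (inj₂ refl)) vc₁
           ∷ rev-keeps-arc C′ t arcs-C′ (C′-misses-c₁ (inj₁ refl)) c₁c₂
           ∷ rev-reverses-arc C′ t arcs-C′ (Edge⇒hasEdge {ps = cycArcs C′} (inj₂ (here refl))) vc₂
           ∷ []
    cycle-T : IsCycle (rev D C′) T
    cycle-T = s≤s (s≤s z≤n) , unique-T , arcs-T

  triangle-first : IsTournament D → IsCycle D (v ∷ c₁ ∷ c₂ ∷ c₃ ∷ r) → Arc D c₂ v →
    Decomposable v (v ∷ c₂ ∷ c₃ ∷ r) → Decomposition D v (v ∷ c₁ ∷ c₂ ∷ c₃ ∷ r)
  triangle-first {D = D} t (_ , uniq , arcs-C@(vc₁ ∷ c₁c₂ ∷ arcs-path)) c₂v decomposable = record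
    { triangles     = T ∷ triangles
    ; isRS          = cycle-T , isRS
    ; all-length-3  = refl ∷ all-length-3
    ; same-reversal = λ x y → trans (rev-split C T C′ t arcs-C arcs-T arcs-C′ split x y) (same-reversal x y)
    ; all-near      = T-near ∷ All.map C′-near⇒C-near all-near
    }
    where
    open Chord uniq
    arcs-T : ArcsOf D (cycArcs T)
    arcs-T = vc₁ ∷ c₁c₂ ∷ c₂v ∷ []
    cycle-T : IsCycle D T
    cycle-T = s≤s (s≤s z≤n) , unique-T , arcs-T
    arcs-C′ : ArcsOf (rev D T) (cycArcs C′)
    arcs-C′ = rev-reverses-arc T t arcs-T (Edge⇒hasEdge {ps = cycArcs T} (inj₂ (there (there (here refl))))) c₂v
            ∷ All.tabulate (λ p → rev-keeps-arc T t arcs-T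
                (¬Edge⇒¬hasEdge (cycArcs T) (λ eT → T-disjoint-path eT (inj₁ p))) (All.lookup arcs-path p))
    open Decomposition (decomposable (rev-isTournament T t arcs-T) (s≤s (s≤s z≤n) , unique-C′ , arcs-C′))
    split : ∀ x y → hasEdge (cycArcs C) x y ≡ hasEdge (cycArcs T) x y xor hasEdge (cycArcs C′) x y
    split x y = trans (hasEdge-split x y) (xor-comm (hasEdge (cycArcs C′) x y) (hasEdge (cycArcs T) x y))

decompose : ∀ (v c₁ c₂ : Fin n) rest → Decomposable v (v ∷ c₁ ∷ c₂ ∷ rest)
decompose v c₁ c₂ [] t cyc = record
  { triangles     = [ v ∷ c₁ ∷ c₂ ∷ [] ]
  ; isRS          = cyc , tt
  ; all-length-3  = refl ∷ []
  ; same-reversal = λ _ _ → refl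
  ; all-near      = All.tabulate (λ p → inj₂ (inj₂ (inj₁ (∈⇒memArc p)))) ∷ []
  }
decompose v c₁ c₂ (c₃ ∷ r) t cyc@(_ , uniq , _) =
  [ (λ vc₂ → triangle-last t cyc vc₂ (decompose v c₂ c₃ r))
  , (λ c₂v → triangle-first t cyc c₂v (decompose v c₂ c₃ r)) ]′
  (proj₁ (proj₂ t v c₂ (Chord.v≢c₂ uniq)))

decompose-from : ∀ (v : Fin n) rest → Decomposable v (v ∷ rest)
decompose-from v []                 t (s≤s () , _)
decompose-from v (c₁ ∷ [])          t (_ , (v≢c₁ ∷ []) AllPairs.∷ _ , vc₁ ∷ c₁v ∷ []) =
  ⊥-elim (proj₂ (proj₂ t v c₁ v≢c₁) (vc₁ , c₁v))
decompose-from v (c₁ ∷ c₂ ∷ rest) = decompose v c₁ c₂ rest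

pathArcs : Fin n → List (Fin n) → Fin n → List (Fin n × Fin n)
pathArcs a []       z = [ (a , z) ]
pathArcs a (b ∷ bs) z = (a , b) ∷ pathArcs b bs z

zip≡pathArcs : ∀ (a : Fin n) as z → zip (a ∷ as) (as ++ [ z ]) ≡ pathArcs a as z
zip≡pathArcs a []       z = refl
zip≡pathArcs a (b ∷ bs) z = cong ((a , b) ∷_) (zip≡pathArcs b bs z)

pathArcs-++ : ∀ (a : Fin n) as b bs z → pathArcs a (as ++ b ∷ bs) z ≡ pathArcs a as b ++ pathArcs b bs z
pathArcs-++ a []       b bs z = refl
pathArcs-++ a (c ∷ cs) b bs z = cong ((a , c) ∷_) (pathArcs-++ c cs b bs z)

cycArcs-split : ∀ (a : Fin n) as b bs → cycArcs (a ∷ as ++ b ∷ bs) ≡ pathArcs a as b ++ pathArcs b bs a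
cycArcs-split a as b bs = trans (zip≡pathArcs a (as ++ b ∷ bs) a) (pathArcs-++ a as b bs a)

memArc-rotate : ∀ xs (v : Fin n) ys x y →
  memArc (cycArcs (xs ++ v ∷ ys)) x y ≡ memArc (cycArcs (v ∷ ys ++ xs)) x y
memArc-rotate []       v ys x y = cong (λ zs → memArc (cycArcs (v ∷ zs)) x y) (sym (++-identityʳ ys))
memArc-rotate (a ∷ as) v ys x y = begin
  memArc (cycArcs (a ∷ as ++ v ∷ ys)) x y
    ≡⟨ cong (λ ps → memArc ps x y) (cycArcs-split a as v ys) ⟩
  memArc (pathArcs a as v ++ pathArcs v ys a) x y
    ≡⟨ memArc-++ (pathArcs a as v) (pathArcs v ys a) ⟩
  memArc (pathArcs a as v) x y ∨ memArc (pathArcs v ys a) x y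
    ≡⟨ ∨-comm (memArc (pathArcs a as v) x y) _ ⟩
  memArc (pathArcs v ys a) x y ∨ memArc (pathArcs a as v) x y
    ≡⟨ memArc-++ (pathArcs v ys a) (pathArcs a as v) ⟨
  memArc (pathArcs v ys a ++ pathArcs a as v) x y
    ≡⟨ cong (λ ps → memArc ps x y) (cycArcs-split v ys a as) ⟨
  memArc (cycArcs (v ∷ ys ++ a ∷ as)) x y
    ∎
  where open ≡-Reasoning

decompose-through : ∀ {C : List (Fin n)} → v ∈ C → Decomposable v C
decompose-through {n = n} {v = v} v∈C {D} t cyc@(long , unique , arcs) with ∈-∃++ v∈C
... | xs , ys , refl = record
  { triangles     = triangles
  ; isRS          = isRS
  ; all-length-3  = all-length-3
  ; same-reversal = λ x y → trans (rev-rotate x y) (same-reversal x y)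
  ; all-near      = All.map (All.map (Near-transfer {K₁ = R} {K₂ = xs ++ v ∷ ys} (inj₂ ∘ unrotate))) all-near
  }
  where
  module P = Permutation (setoid (Fin n))
  R = v ∷ ys ++ xs
  unrotate : ∀ {x y} → (x , y) ∈ cycArcs R → (x , y) ∈ cycArcs (xs ++ v ∷ ys)
  unrotate {x} {y} p = memArc⇒∈ _ (trans (memArc-rotate xs v ys x y) (∈⇒memArc p))
  rev-rotate : ∀ x y → rev D (xs ++ v ∷ ys) x y ≡ rev D R x y
  rev-rotate x y = cong₂ (λ p q → (D x y ∧ not p) ∨ q) (memArc-rotate xs v ys x y) (memArc-rotate xs v ys y x)
  cycle-R : IsCycle D R
  cycle-R = subst (2 ≤_) (length-++-comm xs (v ∷ ys)) long
          , P.Unique-resp-↭ (P.++-comm xs (v ∷ ys)) unique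
          , All.tabulate (λ p → All.lookup arcs (unrotate p))
  open Decomposition (decompose-from v (ys ++ xs) t cycle-R)

proposition9p2 : ∀ {n : ℕ} (D : Digraph n) (C : List (Fin n)) (v : Fin n) →
    IsTournament D → IsCycle D C → v ∈ C →
    Σ (List (List (Fin n))) λ Cv →
      IsRS D Cv ×
      All (λ C′ → length C′ ≡ 3) Cv ×
      ((x y : Fin n) → rev D C x y ≡ revSeq D Cv x y) ×
      All (λ C′ → All (λ { (x , y) → x ≡ v ⊎ y ≡ v ⊎ EdgeOf C x y }) (cycArcs C′)) Cv
proposition9p2 D C v t cyc v∈C = triangles , isRS , all-length-3 , same-reversal , all-near
  where open Decomposition (decompose-through v∈C t cyc)
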